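{- For every $n\ge 1$, the number of integer sequences $e=(e_1,\dots,e_n)$ with $0\le e_i<i$ for all $i\in[n]$ such that there are no indices $i<j<k$ with $e_i\le e_j$, $e_j\ge e_k$ and $e_i\ne e_k$ equals $(n-1)2^{n-2}+1$. -}

module Defs where

open import Data.Nat using (ℕ; zero; suc; _≤_; _<_; _≤?_; _<?_)
open import Data.Nat.Properties using (_≟_)
open import Data.Fin using (Fin; toℕ)
open import Data.Vec using (Vec; lookup)
open import Data.Product using (_×_; Σ)
open import Relation.Nullary using (¬_; Dec)
open import Relation.Nullary.Decidable using (_×-dec_; ¬?)
open import Data.Fin.Properties using (all?; any?)
open import Relation.Binary.PropositionalEquality using (_≡_)

-- A sequence e = (e_1,…,e_n) is stored 0-indexed as a vector; position i (0-based)
-- corresponds to index i+1 of the paper, so the condition 0 ≤ e_{i+1} < i+1 reads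
-- lookup e i < suc (toℕ i).
IsInversionSequence : ∀ {n} → Vec ℕ n → Set
IsInversionSequence {n} e = ∀ (i : Fin n) → lookup e i < suc (toℕ i)

HasPattern : ∀ {n} → Vec ℕ n → Set
HasPattern {n} e =
  Σ (Fin n) λ i → Σ (Fin n) λ j → Σ (Fin n) λ k →
    (toℕ i < toℕ j) × (toℕ j < toℕ k) ×
    (lookup e i ≤ lookup e j) × (lookup e k ≤ lookup e j) × ¬ (lookup e i ≡ lookup e k)

Avoids : ∀ {n} → Vec ℕ n → Set
Avoids e = ¬ HasPattern e

isInversionSequence? : ∀ {n} (e : Vec ℕ n) → Dec (IsInversionSequence e)
isInversionSequence? e = all? λ i → lookup e i <? suc (toℕ i)

hasPattern? : ∀ {n} (e : Vec ℕ n) → Dec (HasPattern e)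
hasPattern? e = any? λ i → any? λ j → any? λ k →
  (toℕ i <? toℕ j) ×-dec (toℕ j <? toℕ k) ×-dec
  (lookup e i ≤? lookup e j) ×-dec (lookup e k ≤? lookup e j) ×-dec
  ¬? (lookup e i ≟ lookup e k)

avoids? : ∀ {n} (e : Vec ℕ n) → Dec (Avoids e)
avoids? e = ¬? (hasPattern? e)

-- An inversion sequence avoids the pattern exactly when it has the shape 0…0 v 0…0 w₁ < ⋯ < wₜ with
-- v < w₁ (v and the run being optional): any other entry completes the pattern, either as a zero after
-- a non-decreasing pair of nonzero entries, or as an entry in (0, m] after e₁ = 0 and an earlier entry m.
-- Scanning left to right with a three-phase automaton turns the count into a recursion.  Because
-- e_i < i, the completions of a strictly increasing run are counted by a binomial coefficient (the
-- slacks i − e_i decrease weakly), those of the single-entry phase by a partial row sum of binomials,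
-- and summing these telescopes by Pascal's rule to (n − 1) 2ⁿ⁻² + 1.

module Submission where

open import Defs
open import Data.Bool using (Bool; true; false; if_then_else_; _∧_; T)
open import Data.Bool.Properties using (T-∧; T-irrelevant)
open import Data.Fin using (Fin; toℕ; fromℕ<)
open import Data.Fin.Properties using (+↔⊎; toℕ<n; toℕ-fromℕ<)
open import Data.Nat using (ℕ; zero; suc; _+_; _*_; _∸_; _^_; _≤_; _<_; _≥_; z≤n; s≤s; z<s; _<ᵇ_)
open import Data.Nat.Combinatorics using (_C_; nCk+nC[k+1]≡[n+1]C[k+1]; k>n⇒nCk≡0)
open import Data.Nat.Properties
open import Algebra.Properties.CommutativeSemigroup +-commutativeSemigroup using (interchange)
open import Data.Nat.Tactic.RingSolver using (solve-∀)
open import Data.Product using (Σ; _×_; _,_; proj₁; proj₂)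
open import Data.Product.Function.Dependent.Propositional using (Σ-↔)
open import Data.Product.Function.NonDependent.Propositional using (_×-↔_)
open import Data.Sum using (_⊎_; inj₁; inj₂)
open import Data.Sum.Function.Propositional using (_⊎-↔_)
open import Data.Unit using (tt)
open import Data.Vec using (Vec; []; _∷_; lookup)
open import Function using (_∘_)
open import Function.Bundles using (_↔_; _⇔_; mk↔ₛ′; mk⇔; Equivalence)
open import Function.Properties.Inverse using (↔-refl; ↔-sym; ↔-trans)
open import Function.Related.Propositional using (module EquationalReasoning)
open import Relation.Nullary using (¬_; yes; no; contradiction)
open import Relation.Nullary.Decidable using (True; T?; toWitness; fromWitness; decidable-stable)
open import Relation.Binary.PropositionalEquality

sumBelow : ℕ → (ℕ → ℕ) → ℕ
sumBelow zero    f = 0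
sumBelow (suc b) f = f 0 + sumBelow b (f ∘ suc)

sumBelow-cong : ∀ b {f g : ℕ → ℕ} → (∀ x → x < b → f x ≡ g x) → sumBelow b f ≡ sumBelow b g
sumBelow-cong zero    f≗g = refl
sumBelow-cong (suc b) f≗g = cong₂ _+_ (f≗g 0 z<s) (sumBelow-cong b (λ x x<b → f≗g (suc x) (s≤s x<b)))

sumBelow-+ : ∀ b (f g : ℕ → ℕ) → sumBelow b (λ x → f x + g x) ≡ sumBelow b f + sumBelow b g
sumBelow-+ zero    f g = refl
sumBelow-+ (suc b) f g = trans (cong (f 0 + g 0 +_) (sumBelow-+ b (f ∘ suc) (g ∘ suc)))
                               (interchange (f 0) (g 0) _ _)

sumBelow-suc : ∀ b (f : ℕ → ℕ) → sumBelow (suc b) f ≡ sumBelow b f + f b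
sumBelow-suc zero    f = +-comm (f 0) 0
sumBelow-suc (suc b) f = trans (cong (f 0 +_) (sumBelow-suc b (f ∘ suc))) (sym (+-assoc (f 0) _ _))

sumBelow-from : ∀ {v q} (h : ℕ → ℕ) → v ≤ q →
  sumBelow q (λ x → if v <ᵇ suc x then h (q ∸ suc x) else 0) ≡ sumBelow (q ∸ v) (λ x → h (q ∸ v ∸ suc x))
sumBelow-from {zero}  h _         = refl
sumBelow-from {suc v} h (s≤s v≤q) = sumBelow-from h v≤q

∀<-extend : ∀ {P : ℕ → Set} {q} → (∀ i → i < q → P i) → P q → ∀ i → i < suc q → P i
∀<-extend below at-q i i<1+q with m<1+n⇒m<n∨m≡n i<1+q
... | inj₁ i<q  = below i i<q
... | inj₂ refl = at-q

Σ-Vec-∷↔ : ∀ {A : Set} {r} (P : Vec A (suc r) → Set) →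
           Σ (Vec A (suc r)) P ↔ Σ A (λ x → Σ (Vec A r) (λ xs → P (x ∷ xs)))
Σ-Vec-∷↔ P = mk↔ₛ′ (λ { (x ∷ xs , p) → x , xs , p }) (λ { (x , xs , p) → x ∷ xs , p })
                   (λ _ → refl) (λ { (x ∷ xs , p) → refl })

Σ-T-∧↔ : ∀ {A : Set} (b : Bool) (B : A → Bool) → Σ A (λ a → T (b ∧ B a)) ↔ (T b × Σ A (T ∘ B))
Σ-T-∧↔ true  B = mk↔ₛ′ (tt ,_) (λ { (_ , s) → s }) (λ _ → refl) (λ _ → refl)
Σ-T-∧↔ false B = mk↔ₛ′ (λ ()) (λ ()) (λ ()) (λ ())

T×Fin↔Fin-if : ∀ b {c} → (T b × Fin c) ↔ Fin (if b then c else 0)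
T×Fin↔Fin-if true  = mk↔ₛ′ (λ { (_ , i) → i }) (tt ,_) (λ _ → refl) (λ _ → refl)
T×Fin↔Fin-if false = mk↔ₛ′ (λ ()) (λ ()) (λ ()) (λ ())

sumBelow↔ : ∀ b (F : ℕ → ℕ) → (Σ ℕ λ x → T (x <ᵇ b) × Fin (F x)) ↔ Fin (sumBelow b F)
sumBelow↔ zero    F = mk↔ₛ′ (λ { (_ , () , _) }) (λ ()) (λ ()) (λ { (_ , () , _) })
sumBelow↔ (suc b) F = ↔-trans peel (↔-trans (↔-refl ⊎-↔ sumBelow↔ b (F ∘ suc)) (↔-sym +↔⊎))
  where
  peel : (Σ ℕ λ x → T (x <ᵇ suc b) × Fin (F x)) ↔ (Fin (F 0) ⊎ Σ ℕ λ x → T (x <ᵇ b) × Fin (F (suc x)))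
  peel = mk↔ₛ′ to from to∘from from∘to
    where
    to : (Σ ℕ λ x → T (x <ᵇ suc b) × Fin (F x)) → Fin (F 0) ⊎ Σ ℕ λ x → T (x <ᵇ b) × Fin (F (suc x))
    to (zero  , _ , i) = inj₁ i
    to (suc x , p , i) = inj₂ (x , p , i)
    from : (Fin (F 0) ⊎ Σ ℕ λ x → T (x <ᵇ b) × Fin (F (suc x))) → Σ ℕ λ x → T (x <ᵇ suc b) × Fin (F x)
    from (inj₁ i)           = zero , tt , i
    from (inj₂ (x , p , i)) = suc x , p , i
    to∘from : ∀ s → to (from s) ≡ s
    to∘from (inj₁ i) = refl
    to∘from (inj₂ _) = refl
    from∘to : ∀ s → from (to s) ≡ s
    from∘to (zero  , _ , _) = refl
    from∘to (suc x , _ , _) = refl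

record IsPascal (f : ℕ → ℕ → ℕ) : Set where
  field
    column₀ : ∀ m → f (suc m) 0 ≡ f m 0
    rule    : ∀ m j → f (suc m) (suc j) ≡ f m (suc j) + f m j

partialSums : (ℕ → ℕ → ℕ) → ℕ → ℕ → ℕ
partialSums f m k = sumBelow k (f m)

partialSums-isPascal : ∀ {f} → IsPascal f → IsPascal (partialSums f)
partialSums-isPascal {f} pascal = record { column₀ = λ _ → refl ; rule = rule′ }
  where
  open IsPascal pascal
  open ≡-Reasoning
  rule′ : ∀ m j → partialSums f (suc m) (suc j) ≡ partialSums f m (suc j) + partialSums f m j
  rule′ m j = begin
    f (suc m) 0 + sumBelow j (λ i → f (suc m) (suc i))
      ≡⟨ cong₂ _+_ (column₀ m) (sumBelow-cong j (λ i _ → rule m i)) ⟩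
    f m 0 + sumBelow j (λ i → f m (suc i) + f m i)
      ≡⟨ cong (f m 0 +_) (sumBelow-+ j (f m ∘ suc) (f m)) ⟩
    f m 0 + (sumBelow j (f m ∘ suc) + sumBelow j (f m))
      ≡⟨ +-assoc (f m 0) _ _ ⟨
    partialSums f m (suc j) + partialSums f m j
      ∎

columnSum : ∀ {f} → IsPascal f → ∀ q r j →
            sumBelow q (λ x → f (q ∸ suc x + r) j) + f r (suc j) ≡ f (q + r) (suc j)
columnSum pascal zero    r j = refl
columnSum {f} pascal (suc q) r j = begin
  f (q + r) j + sumBelow q (λ x → f (q ∸ suc x + r) j) + f r (suc j)
    ≡⟨ +-assoc (f (q + r) j) _ _ ⟩
  f (q + r) j + (sumBelow q (λ x → f (q ∸ suc x + r) j) + f r (suc j))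
    ≡⟨ cong (f (q + r) j +_) (columnSum pascal q r j) ⟩
  f (q + r) j + f (q + r) (suc j)
    ≡⟨ +-comm (f (q + r) j) _ ⟩
  f (q + r) (suc j) + f (q + r) j
    ≡⟨ IsPascal.rule pascal (q + r) j ⟨
  f (suc q + r) (suc j)
    ∎
  where open ≡-Reasoning

C-isPascal : IsPascal _C_
C-isPascal = record
  { column₀ = λ _ → refl
  ; rule    = λ m j → trans (sym (nCk+nC[k+1]≡[n+1]C[k+1] m j)) (+-comm (m C j) _)
  }

hockeyStick : ∀ q r → sumBelow q (λ x → (q ∸ suc x + r) C r) ≡ (q + r) C suc r
hockeyStick q r = begin
  column             ≡⟨ +-identityʳ column ⟨
  column + 0         ≡⟨ cong (column +_) (k>n⇒nCk≡0 (n<1+n r)) ⟨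
  column + r C suc r ≡⟨ columnSum C-isPascal q r r ⟩
  (q + r) C suc r    ∎
  where
  open ≡-Reasoning
  column : ℕ
  column = sumBelow q (λ x → (q ∸ suc x + r) C r)

S₁ S₂ : ℕ → ℕ → ℕ
S₁ = partialSums _C_
S₂ = partialSums S₁

S₁-isPascal : IsPascal S₁
S₁-isPascal = partialSums-isPascal C-isPascal

S₂-isPascal : IsPascal S₂
S₂-isPascal = partialSums-isPascal S₁-isPascal

S₁-row : ∀ m → S₁ m (suc m) ≡ 2 ^ m
S₁-pastRow : ∀ m → S₁ m (2 + m) ≡ 2 ^ m

S₁-row zero    = refl
S₁-row (suc m) = begin
  S₁ (suc m) (2 + m)          ≡⟨ IsPascal.rule S₁-isPascal m (suc m) ⟩
  S₁ m (2 + m) + S₁ m (suc m) ≡⟨ cong₂ _+_ (S₁-pastRow m) (S₁-row m) ⟩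
  2 ^ m + 2 ^ m               ≡⟨ cong (2 ^ m +_) (+-identityʳ (2 ^ m)) ⟨
  2 ^ suc m                   ∎
  where open ≡-Reasoning

S₁-pastRow m = begin
  S₁ m (2 + m)             ≡⟨ sumBelow-suc (suc m) (m C_) ⟩
  S₁ m (suc m) + m C suc m ≡⟨ cong₂ _+_ (S₁-row m) (k>n⇒nCk≡0 (n<1+n m)) ⟩
  2 ^ m + 0                ≡⟨ +-identityʳ _ ⟩
  2 ^ m                    ∎
  where open ≡-Reasoning

S₂-pastDiagonal : ∀ m → S₂ m (3 + m) ≡ S₂ m (2 + m) + 2 ^ m
S₂-pastDiagonal m = trans (sumBelow-suc (2 + m) (S₁ m)) (cong (S₂ m (2 + m) +_) (S₁-pastRow m))

S₂-diagonal : ∀ k → S₂ (suc k) (3 + k) ≡ (3 + k) * 2 ^ k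
S₂-diagonal zero    = refl
S₂-diagonal (suc k) = begin
  S₂ (2 + k) (4 + k)
    ≡⟨ IsPascal.rule S₂-isPascal (suc k) (3 + k) ⟩
  S₂ (suc k) (4 + k) + S₂ (suc k) (3 + k)
    ≡⟨ cong (_+ S₂ (suc k) (3 + k)) (S₂-pastDiagonal (suc k)) ⟩
  S₂ (suc k) (3 + k) + 2 ^ suc k + S₂ (suc k) (3 + k)
    ≡⟨ cong (λ s → s + 2 ^ suc k + s) (S₂-diagonal k) ⟩
  (3 + k) * 2 ^ k + 2 ^ suc k + (3 + k) * 2 ^ k
    ≡⟨ solve (2 ^ k) k ⟩
  (4 + k) * 2 ^ suc k
    ∎
  where
  open ≡-Reasoning
  solve : ∀ p k → (3 + k) * p + 2 * p + (3 + k) * p ≡ (4 + k) * (2 * p)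
  solve = solve-∀

-- After a prefix: zeros = only zeros so far; single v = exactly one nonzero entry, v;
-- rising v = the strictly increasing run has begun, and v is its last (largest) entry.
data Phase : Set where
  zeros  : Phase
  single : ℕ → Phase
  rising : ℕ → Phase

allowed : Phase → ℕ → Bool
allowed zeros      x       = true
allowed (single v) zero    = true
allowed (single v) (suc x) = v <ᵇ suc x
allowed (rising v) x       = v <ᵇ x

step : Phase → ℕ → Phase
step zeros      zero    = zeros
step zeros      (suc x) = single (suc x)
step (single v) zero    = single v
step (single v) (suc x) = rising (suc x)
step (rising v) x       = rising x

-- accepts q ph v reads v as the entries at positions q, q + 1, … (counted from 0).
accepts : ∀ {r} → ℕ → Phase → Vec ℕ r → Bool
accepts q ph []       = true
accepts q ph (x ∷ xs) = (x <ᵇ suc q) ∧ (allowed ph x ∧ accepts (suc q) (step ph x) xs)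

at : ∀ {n} → Vec ℕ n → ℕ → ℕ
at []       i       = 0
at (x ∷ xs) zero    = x
at (x ∷ xs) (suc i) = at xs i

module Prefix (a : ℕ → ℕ) where

  InversionBelow : ℕ → Set
  InversionBelow N = ∀ i → i < N → a i ≤ i

  PatternEndingAt : ℕ → Set
  PatternEndingAt k = Σ ℕ λ i → Σ ℕ λ j → i < j × j < k × a i ≤ a j × a k ≤ a j × a i ≢ a k

  PatternBelow : ℕ → Set
  PatternBelow N = Σ ℕ λ k → k < N × PatternEndingAt k

  Avoider : ℕ → Set
  Avoider N = InversionBelow N × ¬ PatternBelow N

  PhaseInvariant : ℕ → Phase → Set
  PhaseInvariant q zeros      = ∀ i → i < q → a i ≡ 0
  PhaseInvariant q (single v) = 0 < v × Σ ℕ λ p → p < q × a p ≡ v × (∀ i → i < q → i ≢ p → a i ≡ 0)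
  PhaseInvariant q (rising v) =
    (Σ ℕ λ i → Σ ℕ λ j → i < j × j < q × a i ≤ a j × a i ≢ 0) ×
    (∀ i → i < q → a i ≤ v) × (Σ ℕ λ j → j < q × a j ≡ v)

  Avoider-antitone : ∀ {M N} → M ≤ N → Avoider N → Avoider M
  Avoider-antitone M≤N (inv , noPat) =
    (λ i i<M → inv i (<-≤-trans i<M M≤N)) , (λ { (k , k<M , pat) → noPat (k , <-≤-trans k<M M≤N , pat) })

  Avoider-suc : ∀ {q} → Avoider q → a q ≤ q → ¬ PatternEndingAt q → Avoider (suc q)
  Avoider-suc (inv , noPat) aq≤q noPatq =
    ∀<-extend inv aq≤q ,
    λ { (k , k<1+q , pat) →
          ∀<-extend {λ k → ¬ PatternEndingAt k} (λ k k<q pat → noPat (k , k<q , pat)) noPatq k k<1+q pat }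

  first≡0 : ∀ {q} → InversionBelow q → 0 < q → a 0 ≡ 0
  first≡0 inv 0<q = n≤0⇒n≡0 (inv 0 0<q)

  zeros-noPattern : ∀ {q} → PhaseInvariant q zeros → ¬ PatternEndingAt q
  zeros-noPattern allZero (i , j , i<j , j<q , _ , aq≤aj , ai≢aq) =
    ai≢aq (trans (allZero i (<-trans i<j j<q)) (sym (n≤0⇒n≡0 (subst (a _ ≤_) (allZero j j<q) aq≤aj))))

  dominant-noPattern : ∀ {q} → (∀ j → j < q → a j < a q) → ¬ PatternEndingAt q
  dominant-noPattern dominant (_ , j , _ , j<q , _ , aq≤aj , _) = <⇒≱ (dominant j j<q) aq≤aj

  single-bounded : ∀ {q v} → PhaseInvariant q (single v) → ∀ j → j < q → a j ≤ v
  single-bounded (_ , p , _ , ap≡v , others) j j<q with j ≟ p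
  ... | yes refl = ≤-reflexive ap≡v
  ... | no  j≢p  = subst (_≤ _) (sym (others j j<q j≢p)) z≤n

  single-zeroBefore : ∀ {q v i j} → PhaseInvariant q (single v) → i < j → j < q → a i ≤ a j → a i ≡ 0
  single-zeroBefore {j = j} (_ , p , _ , _ , others) i<j j<q ai≤aj with j ≟ p
  ... | yes refl = others _ (<-trans i<j j<q) (<⇒≢ i<j)
  ... | no  j≢p  = n≤0⇒n≡0 (subst (a _ ≤_) (others j j<q j≢p) ai≤aj)

  rising-invariant : ∀ {q v x} → (Σ ℕ λ i → Σ ℕ λ j → i < j × j < suc q × a i ≤ a j × a i ≢ 0) →
                     (∀ i → i < q → a i ≤ v) → v < x → a q ≡ x → PhaseInvariant (suc q) (rising x)
  rising-invariant {q} pair bounded v<x aq≡x =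
    pair , ∀<-extend (λ i i<q → ≤-trans (bounded i i<q) (<⇒≤ v<x)) (≤-reflexive aq≡x) , (q , n<1+n q , aq≡x)

  allowed-sound : ∀ {q} ph x → PhaseInvariant q ph → a q ≡ x → T (allowed ph x) →
                  ¬ PatternEndingAt q × PhaseInvariant (suc q) (step ph x)
  allowed-sound zeros zero allZero aq≡0 _ = zeros-noPattern allZero , ∀<-extend allZero aq≡0
  allowed-sound {q} zeros (suc x) allZero aq≡x _ =
    zeros-noPattern allZero
    , (z<s , q , n<1+n q , aq≡x , ∀<-extend (λ i i<q _ → allZero i i<q) (λ q≢q → contradiction refl q≢q))
  allowed-sound (single v) zero inv@(0<v , p , p<q , ap≡v , others) aq≡0 _ =
    (λ { (i , j , i<j , j<q , ai≤aj , _ , ai≢aq) → ai≢aq (trans (single-zeroBefore inv i<j j<q ai≤aj) (sym aq≡0)) })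
    , (0<v , p , m<n⇒m<1+n p<q , ap≡v , ∀<-extend others (λ _ → aq≡0))
  allowed-sound {q} (single v) (suc x) inv@(0<v , p , p<q , ap≡v , _) aq≡x v<ᵇx =
    dominant-noPattern (λ j j<q → ≤-<-trans (single-bounded inv j j<q) v<aq)
    , rising-invariant (p , q , p<q , n<1+n q , subst (_≤ a q) (sym ap≡v) (<⇒≤ v<aq) ,
                        λ ap≡0 → <⇒≢ 0<v (trans (sym ap≡0) ap≡v))
                       (single-bounded inv) v<x aq≡x
    where
    v<x : v < suc x
    v<x = <ᵇ⇒< v (suc x) v<ᵇx
    v<aq : v < a q
    v<aq = subst (v <_) (sym aq≡x) v<x
  allowed-sound (rising v) x ((i , j , i<j , j<q , pair) , bounded , _) aq≡x v<ᵇx =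
    dominant-noPattern (λ k k<q → ≤-<-trans (bounded k k<q) (subst (v <_) (sym aq≡x) v<x))
    , rising-invariant (i , j , i<j , m<n⇒m<1+n j<q , pair) bounded v<x aq≡x
    where
    v<x : v < x
    v<x = <ᵇ⇒< v x v<ᵇx

  peak-pattern : ∀ {q j x} → InversionBelow q → j < q → 0 < x → x ≤ a j → a q ≡ x → PatternEndingAt q
  peak-pattern {q} {zero} inv j<q 0<x x≤aj _ = contradiction (subst (_ ≤_) (first≡0 inv j<q) x≤aj) (<⇒≱ 0<x)
  peak-pattern {q} {suc j} inv j<q 0<x x≤aj aq≡x =
    0 , suc j , z<s , j<q , subst (_≤ a (suc j)) (sym a₀≡0) z≤n , subst (_≤ _) (sym aq≡x) x≤aj
    , λ a₀≡aq → <⇒≢ 0<x (trans (sym a₀≡0) (trans a₀≡aq aq≡x))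
    where
    a₀≡0 : a 0 ≡ 0
    a₀≡0 = first≡0 inv (≤-<-trans z≤n j<q)

  -- A zero after the witnessed pair, or a small entry after a₀ = 0 and the peak, completes the pattern.
  disallowed⇒pattern : ∀ {q} ph x → InversionBelow q → PhaseInvariant q ph → a q ≡ x → ¬ T (allowed ph x) →
                       PatternEndingAt q
  disallowed⇒pattern zeros      x       _   _ _ notAllowed = contradiction tt notAllowed
  disallowed⇒pattern (single v) zero    _   _ _ notAllowed = contradiction tt notAllowed
  disallowed⇒pattern (single v) (suc x) inv (_ , p , p<q , ap≡v , _) aq≡x notAllowed =
    peak-pattern inv p<q z<s (subst (_ ≤_) (sym ap≡v) (≮⇒≥ (notAllowed ∘ <⇒<ᵇ))) aq≡x
  disallowed⇒pattern (rising v) zero    _   ((i , j , i<j , j<q , ai≤aj , ai≢0) , _) aq≡0 _ =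
    i , j , i<j , j<q , ai≤aj , subst (_≤ a j) (sym aq≡0) z≤n , λ ai≡aq → ai≢0 (trans ai≡aq aq≡0)
  disallowed⇒pattern (rising v) (suc x) inv (_ , _ , (j , j<q , aj≡v)) aq≡x notAllowed =
    peak-pattern inv j<q z<s (subst (_ ≤_) (sym aj≡v) (≮⇒≥ (notAllowed ∘ <⇒<ᵇ))) aq≡x

  accepts⇔avoider : ∀ {r} q ph (v : Vec ℕ r) → (∀ i → at v i ≡ a (q + i)) →
                  PhaseInvariant q ph → Avoider q → ∀ {N} → q + r ≡ N → T (accepts q ph v) ⇔ Avoider N
  accepts⇔avoider q ph [] _ _ avoids q+0≡N =
    mk⇔ (λ _ → subst Avoider (trans (sym (+-identityʳ q)) q+0≡N) avoids) (λ _ → tt)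
  accepts⇔avoider {suc r} q ph (x ∷ xs) v≗a inv avoids {N} q+r≡N = mk⇔ accepted⇒avoider avoider⇒accepted
    where
    aq≡x : a q ≡ x
    aq≡x = sym (trans (v≗a 0) (cong a (+-identityʳ q)))
    xs≗a : ∀ i → at xs i ≡ a (suc q + i)
    xs≗a i = trans (v≗a (suc i)) (cong a (+-suc q i))
    1+q+r≡N : suc q + r ≡ N
    1+q+r≡N = trans (sym (+-suc q r)) q+r≡N
    rest : PhaseInvariant (suc q) (step ph x) → Avoider (suc q) → T (accepts (suc q) (step ph x) xs) ⇔ Avoider N
    rest inv′ avoids′ = accepts⇔avoider (suc q) (step ph x) xs xs≗a inv′ avoids′ 1+q+r≡N

    accepted⇒avoider : T (accepts q ph (x ∷ xs)) → Avoider N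
    accepted⇒avoider t with Equivalence.to T-∧ t
    ... | x<1+q , t′ with Equivalence.to T-∧ t′
    ... | ok , t″ with allowed-sound ph x inv aq≡x ok
    ... | noPat , inv′ = Equivalence.to (rest inv′ (Avoider-suc avoids aq≤q noPat)) t″
      where
      aq≤q : a q ≤ q
      aq≤q = subst (_≤ q) (sym aq≡x) (≤-pred (<ᵇ⇒< x (suc q) x<1+q))

    avoider⇒accepted : Avoider N → T (accepts q ph (x ∷ xs))
    avoider⇒accepted avoidsN =
      Equivalence.from T-∧ (<⇒<ᵇ (s≤s (subst (_≤ q) aq≡x aq≤q)) ,
                            Equivalence.from T-∧ (ok , Equivalence.from (rest inv′ avoids′) avoidsN))
      where
      avoids′ : Avoider (suc q)
      avoids′ = Avoider-antitone (subst (suc q ≤_) q+r≡N (m<m+n q z<s)) avoidsN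
      aq≤q : a q ≤ q
      aq≤q = proj₁ avoids′ q (n<1+n q)
      ok : T (allowed ph x)
      ok = decidable-stable (T? (allowed ph x))
             (λ notAllowed → proj₂ avoids′ (q , n<1+n q , disallowed⇒pattern ph x (proj₁ avoids) inv aq≡x notAllowed))
      inv′ : PhaseInvariant (suc q) (step ph x)
      inv′ = proj₂ (allowed-sound ph x inv aq≡x ok)

lookup≡at : ∀ {n} (e : Vec ℕ n) i → lookup e i ≡ at e (toℕ i)
lookup≡at (x ∷ xs) Fin.zero    = refl
lookup≡at (x ∷ xs) (Fin.suc i) = lookup≡at xs i

lookup-fromℕ<≡at : ∀ {n} (e : Vec ℕ n) {i} (i<n : i < n) → lookup e (fromℕ< i<n) ≡ at e i
lookup-fromℕ<≡at e i<n = trans (lookup≡at e (fromℕ< i<n)) (cong (at e) (toℕ-fromℕ< i<n))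

module _ {n} (e : Vec ℕ n) where
  open Prefix (at e)

  inversionSequence⇔ : IsInversionSequence e ⇔ InversionBelow n
  inversionSequence⇔ = mk⇔
    (λ isInv i i<n → ≤-pred (subst₂ _<_ (lookup-fromℕ<≡at e i<n) (cong suc (toℕ-fromℕ< i<n)) (isInv (fromℕ< i<n))))
    (λ inv i → s≤s (subst (_≤ toℕ i) (sym (lookup≡at e i)) (inv (toℕ i) (toℕ<n i))))

  pattern⇔ : HasPattern e ⇔ PatternBelow n
  pattern⇔ = mk⇔ to from
    where
    asFin : ∀ {m} → m < n → Σ (Fin n) λ f → toℕ f ≡ m
    asFin m<n = fromℕ< m<n , toℕ-fromℕ< m<n
    to : HasPattern e → PatternBelow n
    to (i , j , k , i<j , j<k , ei≤ej , ek≤ej , ei≢ek)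
      rewrite lookup≡at e i | lookup≡at e j | lookup≡at e k =
      toℕ k , toℕ<n k , toℕ i , toℕ j , i<j , j<k , ei≤ej , ek≤ej , ei≢ek
    from : PatternBelow n → HasPattern e
    from (k , k<n , i , j , i<j , j<k , pat)
      with asFin (<-trans i<j (<-trans j<k k<n)) | asFin (<-trans j<k k<n) | asFin k<n
    ... | fi , refl | fj , refl | fk , refl
      rewrite sym (lookup≡at e fi) | sym (lookup≡at e fj) | sym (lookup≡at e fk) = fi , fj , fk , i<j , j<k , pat

  avoider⇔accepted : (True (isInversionSequence? e) × True (avoids? e)) ⇔ T (accepts 0 zeros e)
  avoider⇔accepted = mk⇔
    (λ (isInv , avoids) → Equivalence.from accepts⇔avoider₀
      (Equivalence.to inversionSequence⇔ (toWitness isInv) , toWitness avoids ∘ Equivalence.from pattern⇔))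
    (λ accepted → let (inv , noPat) = Equivalence.to accepts⇔avoider₀ accepted in
      fromWitness (Equivalence.from inversionSequence⇔ inv) , fromWitness (noPat ∘ Equivalence.to pattern⇔))
    where
    accepts⇔avoider₀ : T (accepts 0 zeros e) ⇔ Avoider n
    accepts⇔avoider₀ = accepts⇔avoider 0 zeros e (λ _ → refl) (λ _ ()) ((λ _ ()) , λ ()) refl

avoiders↔accepted : ∀ n → (Σ (Vec ℕ n) λ e → True (isInversionSequence? e) × True (avoids? e))
                          ↔ Σ (Vec ℕ n) (T ∘ accepts 0 zeros)
avoiders↔accepted n = Σ-↔ ↔-refl λ {e} →
  mk↔ₛ′ (Equivalence.to (avoider⇔accepted e)) (Equivalence.from (avoider⇔accepted e))
        (λ _ → T-irrelevant _ _) (λ _ → cong₂ _,_ (T-irrelevant _ _) (T-irrelevant _ _))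

count : ℕ → Phase → ℕ → ℕ
count q ph zero    = 1
count q ph (suc r) = sumBelow (suc q) λ x → if allowed ph x then count (suc q) (step ph x) r else 0

accepted↔count : ∀ r q ph → Σ (Vec ℕ r) (T ∘ accepts q ph) ↔ Fin (count q ph r)
accepted↔count zero    q ph =
  mk↔ₛ′ (λ _ → Fin.zero) (λ _ → [] , tt) (λ { Fin.zero → refl ; (Fin.suc ()) }) (λ { ([] , tt) → refl })
accepted↔count (suc r) q ph = begin
  Σ (Vec ℕ (suc r)) (T ∘ accepts q ph)
    ↔⟨ Σ-Vec-∷↔ (T ∘ accepts q ph) ⟩
  (Σ ℕ λ x → Σ (Vec ℕ r) λ xs → T (accepts q ph (x ∷ xs)))
    ↔⟨ Σ-↔ ↔-refl (λ {x} → byFirstEntry x) ⟩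
  (Σ ℕ λ x → T (x <ᵇ suc q) × Fin (if allowed ph x then count (suc q) (step ph x) r else 0))
    ↔⟨ sumBelow↔ (suc q) _ ⟩
  Fin (count q ph (suc r))
    ∎
  where
  open EquationalReasoning
  byFirstEntry : ∀ x → (Σ (Vec ℕ r) λ xs → T (accepts q ph (x ∷ xs)))
                     ↔ (T (x <ᵇ suc q) × Fin (if allowed ph x then count (suc q) (step ph x) r else 0))
  byFirstEntry x =
    ↔-trans (Σ-T-∧↔ (x <ᵇ suc q) _)
      (↔-refl ×-↔ ↔-trans (Σ-T-∧↔ (allowed ph x) _)
                          (↔-trans (↔-refl ×-↔ accepted↔count r (suc q) (step ph x)) (T×Fin↔Fin-if (allowed ph x))))

m∸[1+n]+[1+o]≡m∸n+o : ∀ {v q} r → v < q → q ∸ suc v + suc r ≡ q ∸ v + r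
m∸[1+n]+[1+o]≡m∸n+o {v} {q} r v<q = trans (+-suc (q ∸ suc v) r) (cong (_+ r) (sym (+-∸-assoc 1 v<q)))

count-rising : ∀ r {q v} → v < q → count q (rising v) r ≡ (q ∸ suc v + r) C r
count-rising zero    v<q = refl
count-rising (suc r) {q} {v} v<q = begin
  sumBelow q (λ x → if v <ᵇ suc x then count (suc q) (rising (suc x)) r else 0)
    ≡⟨ sumBelow-cong q (λ x x<q → cong (if v <ᵇ suc x then_else 0) (count-rising r (s≤s x<q))) ⟩
  sumBelow q (λ x → if v <ᵇ suc x then (q ∸ suc x + r) C r else 0)
    ≡⟨ sumBelow-from (λ y → (y + r) C r) (<⇒≤ v<q) ⟩
  sumBelow (q ∸ v) (λ x → (q ∸ v ∸ suc x + r) C r)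
    ≡⟨ hockeyStick (q ∸ v) r ⟩
  (q ∸ v + r) C suc r
    ≡⟨ cong (_C suc r) (m∸[1+n]+[1+o]≡m∸n+o r v<q) ⟨
  (q ∸ suc v + suc r) C suc r
    ∎
  where open ≡-Reasoning

count-single : ∀ r {q v} → v < q → count q (single v) r ≡ S₁ (q ∸ suc v + r) (suc r)
count-single zero    v<q = refl
count-single (suc r) {q} {v} v<q = begin
  count (suc q) (single v) r + count q (rising v) (suc r)
    ≡⟨ cong₂ _+_ (count-single r (m<n⇒m<1+n v<q)) (count-rising (suc r) v<q) ⟩
  S₁ (q ∸ v + r) (suc r) + (q ∸ suc v + suc r) C suc r
    ≡⟨ cong (λ m → S₁ (q ∸ v + r) (suc r) + m C suc r) (m∸[1+n]+[1+o]≡m∸n+o r v<q) ⟩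
  S₁ (q ∸ v + r) (suc r) + (q ∸ v + r) C suc r
    ≡⟨ sumBelow-suc (suc r) ((q ∸ v + r) C_) ⟨
  S₁ (q ∸ v + r) (2 + r)
    ≡⟨ cong (λ m → S₁ m (2 + r)) (m∸[1+n]+[1+o]≡m∸n+o r v<q) ⟨
  S₁ (q ∸ suc v + suc r) (2 + r)
    ∎
  where open ≡-Reasoning

count-single-sum : ∀ q r → sumBelow q (λ x → count (suc q) (single (suc x)) r) + 2 ^ r ≡ S₁ (q + r) (2 + r)
count-single-sum q r = begin
  sumBelow q (λ x → count (suc q) (single (suc x)) r) + 2 ^ r
    ≡⟨ cong₂ _+_ (sumBelow-cong q (λ x x<q → count-single r (s≤s x<q))) (sym (S₁-pastRow r)) ⟩
  sumBelow q (λ x → S₁ (q ∸ suc x + r) (suc r)) + S₁ r (2 + r)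
    ≡⟨ columnSum S₁-isPascal q r (suc r) ⟩
  S₁ (q + r) (2 + r)
    ∎
  where open ≡-Reasoning

count-zeros : ∀ r q → count q zeros r + 2 ^ r ≡ 1 + S₂ (q + r ∸ 1) (2 + r)
count-zeros zero    q = refl
count-zeros (suc r) q = begin
  count (suc q) zeros r + sumBelow q (λ x → count (suc q) (single (suc x)) r) + 2 ^ suc r
    ≡⟨ solve (count (suc q) zeros r) _ (2 ^ r) ⟩
  count (suc q) zeros r + 2 ^ r + (sumBelow q (λ x → count (suc q) (single (suc x)) r) + 2 ^ r)
    ≡⟨ cong₂ _+_ (count-zeros r (suc q)) (count-single-sum q r) ⟩
  1 + (S₂ (q + r) (2 + r) + S₁ (q + r) (2 + r))
    ≡⟨ cong suc (sumBelow-suc (2 + r) (S₁ (q + r))) ⟨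
  1 + S₂ (q + r) (3 + r)
    ≡⟨ cong (λ m → 1 + S₂ (m ∸ 1) (3 + r)) (+-suc q r) ⟨
  1 + S₂ (q + suc r ∸ 1) (3 + r)
    ∎
  where
  open ≡-Reasoning
  solve : ∀ c s p → c + s + 2 * p ≡ c + p + (s + p)
  solve = solve-∀

count-closedForm : ∀ m → count 0 zeros (suc m) ≡ m * 2 ^ (m ∸ 1) + 1
count-closedForm zero    = refl
count-closedForm (suc k) = +-cancelʳ-≡ (2 ^ (2 + k)) _ _ (begin
  count 0 zeros (2 + k) + 2 ^ (2 + k)  ≡⟨ count-zeros (2 + k) 0 ⟩
  1 + S₂ (suc k) (4 + k)               ≡⟨ cong suc (S₂-pastDiagonal (suc k)) ⟩
  1 + (S₂ (suc k) (3 + k) + 2 ^ suc k) ≡⟨ cong (λ s → 1 + (s + 2 ^ suc k)) (S₂-diagonal k) ⟩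
  1 + ((3 + k) * 2 ^ k + 2 ^ suc k)    ≡⟨ solve (2 ^ k) k ⟩
  (suc k * 2 ^ k + 1) + 2 ^ (2 + k)    ∎)
  where
  open ≡-Reasoning
  solve : ∀ p k → 1 + ((3 + k) * p + 2 * p) ≡ (suc k * p + 1) + 2 * (2 * p)
  solve = solve-∀

mainTheorem9 : (n : ℕ) → n ≥ 1 →
    (Σ (Vec ℕ n) λ e → True (isInversionSequence? e) × True (avoids? e))
      ↔ Fin ((n ∸ 1) * 2 ^ (n ∸ 2) + 1)
mainTheorem9 (suc m) _ = begin
  (Σ (Vec ℕ (suc m)) λ e → True (isInversionSequence? e) × True (avoids? e)) ↔⟨ avoiders↔accepted (suc m) ⟩
  Σ (Vec ℕ (suc m)) (T ∘ accepts 0 zeros)                                      ↔⟨ accepted↔count (suc m) 0 zeros ⟩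
  Fin (count 0 zeros (suc m))                                                   ≡⟨ cong Fin (count-closedForm m) ⟩
  Fin (m * 2 ^ (m ∸ 1) + 1)                                                     ∎
  where open EquationalReasoning
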